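{- For all graphs $G$ and $H$, $h(G)+h(H)\le h(G\nabla H)\le \min\bigl(h(G)+n(H),\,h(H)+n(G)\bigr)$.
   Context: Graphs are finite, undirected, with no parallel edges, possibly with loops; $n(G)=|V(G)|$. The join $G\nabla H$ of vertex-disjoint graphs $G,H$ has vertex set $V(G)\cup V(H)$ and edge set $E(G)\cup E(H)\cup\{uv: u\in V(G), v\in V(H)\}$. For $A\subseteq V$, $N(A)$ is the set of vertices having a neighbor in $A$. A hunter strategy $(W_t)_{t\ge1}$ gives rabbit territory $R_1=V\setminus W_1$, $R_t=N(R_{t-1})\setminus W_t$; it is winning if $R_T=\emptyset$ for some finite $T$; the hunting number $h(G)$ is the minimum $k$ such that a winning strategy with $|W_t|\le k$ for all $t$ exists. -}

module Defs where

open import Data.Bool using (Bool; true; false; _∧_)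
open import Data.Nat using (ℕ; zero; suc; _+_; _≤_)
open import Data.Fin using (Fin; splitAt)
open import Data.Sum using (inj₁; inj₂)
open import Data.Vec using (tabulate; lookup)
open import Data.List using (allFin)
open import Data.Bool.ListAction using (any)
open import Data.Product using (∃; Σ; _×_)
open import Data.Fin.Subset using (Subset; ∁; _─_; ⊥; ∣_∣)
open import Relation.Binary.PropositionalEquality using (_≡_)

-- A finite undirected graph without parallel edges, loops allowed:
-- vertex set Fin n, a symmetric Boolean adjacency relation
-- (adj v v ≡ true means a loop at v).
record Graph : Set where
  field
    n   : ℕ
    adj : Fin n → Fin n → Bool
    sym : ∀ u v → adj u v ≡ adj v u
open Graph public

joinAdj : (G H : Graph) → Fin (n G + n H) → Fin (n G + n H) → Bool
joinAdj G H u v with splitAt (n G) u | splitAt (n G) v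
... | inj₁ a | inj₁ b = adj G a b
... | inj₂ a | inj₂ b = adj H a b
... | inj₁ _ | inj₂ _ = true
... | inj₂ _ | inj₁ _ = true

joinSym : (G H : Graph) → ∀ u v → joinAdj G H u v ≡ joinAdj G H v u
joinSym G H u v with splitAt (n G) u | splitAt (n G) v
... | inj₁ a | inj₁ b = sym G a b
... | inj₂ a | inj₂ b = sym H a b
... | inj₁ _ | inj₂ _ = _≡_.refl
... | inj₂ _ | inj₁ _ = _≡_.refl

_∇_ : Graph → Graph → Graph
G ∇ H = record { n = n G + n H ; adj = joinAdj G H ; sym = joinSym G H }

N : (G : Graph) → Subset (n G) → Subset (n G)
N G A = tabulate λ v → any (λ u → lookup A u ∧ adj G u v) (allFin (n G))

-- A hunter strategy is a sequence W : ℕ → Subset; index t here is the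
-- paper's time t+1 (so W 0 = W₁).
Strategy : Graph → Set
Strategy G = ℕ → Subset (n G)

territory : (G : Graph) → Strategy G → ℕ → Subset (n G)
territory G W zero    = ∁ (W zero)
territory G W (suc t) = N G (territory G W t) ─ W (suc t)

Winning : (G : Graph) → Strategy G → Set
Winning G W = ∃ λ T → territory G W T ≡ ⊥

Wins : Graph → ℕ → Set
Wins G k = Σ (Strategy G) λ W → Winning G W × (∀ t → ∣ W t ∣ ≤ k)

IsHuntingNumber : Graph → ℕ → Set
IsHuntingNumber G k = Wins G k × (∀ j → Wins G j → k ≤ j)

{-# OPTIONS --safe #-}
-- Upper bound: on X ∇ Y, shooting all of Y in every round confines the rabbit to X, where an
-- optimal strategy for X catches it.
--
-- Lower bound: let k < h(X) + h(Y) hunters play on X ∇ Y. In every round one side holds fewer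
-- hunters than its hunting number. If the rabbit may be somewhere in Y at time t, then at time t + 1
-- it may be on every unshot vertex of X; if its territory then misses X, all of X is shot, which
-- leaves fewer than h(Y) hunters for Y. Call X a hideout at time t if, from a time u ≤ t at which the
-- rabbit may be on every unshot vertex of X, X never held h(X) hunters or more: the hunters' moves
-- inside X from u on then form a strategy on X with fewer than h(X) hunters, so they cannot have
-- cleared X by time t. An induction on t, alternating the roles of X and Y, shows that whenever the
-- territory misses Y, X is a hideout; so the territory never becomes empty.
module Submission where

open import Defs hiding (sym)
open import Data.Bool using (Bool; true)
open import Data.Bool.Properties using (T-≡; T-∧)
open import Data.Empty using (⊥-elim)
open import Data.Fin using (Fin; _↑ˡ_; _↑ʳ_)
open import Data.Fin.Properties using (+↔⊎; splitAt-↑ˡ; splitAt-↑ʳ)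
open import Data.Fin.Subset
  using (Subset; _∈_; _∉_; _⊆_; ⊤; ⊥; ∁; _─_; ∣_∣; Nonempty; Empty; inside; outside)
open import Data.Fin.Subset.Properties
  using (_∈?_; nonempty?; Empty-unique; ∉⊥; ∈⊤; ∣⊥∣≡0; ∣⊤∣≡n; p⊆q⇒∣p∣≤∣q∣;
         x∈∁p⇒x∉p; x∉p⇒x∈∁p; x∈p∧x∉q⇒x∈p─q; p─q⊆p)
open import Data.List using (allFin)
open import Data.List.Membership.Propositional using (lose)
open import Data.List.Membership.Propositional.Properties using (∈-allFin)
open import Data.List.Relation.Unary.Any using (satisfied)
open import Data.List.Relation.Unary.Any.Properties using (any⁺; any⁻)
open import Data.Nat using (ℕ; zero; suc; _+_; _≤_; _<_; _≤?_; _<?_; z≤n; _⊓_)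
open import Data.Nat.Properties
  using (≤-refl; ≤-reflexive; ≤-pred; m≤n⇒m≤1+n; m≤n⇒m<n∨m≡n; n≮0; 1+n≰n; ≮⇒≥; ≰⇒>;
         +-comm; +-mono-≤; +-monoʳ-≤; +-cancelʳ-<; ⊓-glb; module ≤-Reasoning)
open import Data.Product using (∃-syntax; _×_; _,_; proj₁)
open import Data.Sum using (_⊎_; inj₁; inj₂; [_,_]′)
open import Data.Sum.Properties using (swap-↔)
open import Data.Unit using (tt) renaming (⊤ to Unit)
open import Data.Vec using (_∷_; here; there; tabulate; lookup)
open import Data.Vec.Properties
  using (lookup∘tabulate; tabulate∘lookup; tabulate-cong; []=⇒lookup; lookup⇒[]=)
open import Function using (_∘_)
open import Function.Bundles using (_↔_; Inverse; Equivalence)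
open import Function.Construct.Composition using (_↔-∘_)
open import Relation.Binary.PropositionalEquality
open import Relation.Nullary using (¬_; yes; no; contradiction)

private
  variable
    m m′ : ℕ

x∈p─q⇒x∉q : {x : Fin m} {p q : Subset m} → x ∈ p ─ q → x ∉ q
x∈p─q⇒x∉q {p = _ ∷ _} {inside ∷ _} () here
x∈p─q⇒x∉q {p = _ ∷ _} {_ ∷ _} (there x∈p─q) (there x∈q) = x∈p─q⇒x∉q x∈p─q x∈q

∈-tabulate⁺ : {f : Fin m → Bool} {x : Fin m} → f x ≡ true → x ∈ tabulate f
∈-tabulate⁺ {f = f} {x} fx≡true = lookup⇒[]= x (tabulate f) (trans (lookup∘tabulate f x) fx≡true)

∈-tabulate⁻ : {f : Fin m → Bool} {x : Fin m} → x ∈ tabulate f → f x ≡ true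
∈-tabulate⁻ {f = f} {x} x∈ = trans (sym (lookup∘tabulate f x)) ([]=⇒lookup x∈)

preimage : (Fin m → Fin m′) → Subset m′ → Subset m
preimage e S = tabulate (λ x → lookup S (e x))

module _ {e : Fin m → Fin m′} {S : Subset m′} {x : Fin m} where

  ∈-preimage⁺ : e x ∈ S → x ∈ preimage e S
  ∈-preimage⁺ ex∈S = ∈-tabulate⁺ ([]=⇒lookup ex∈S)

  ∈-preimage⁻ : x ∈ preimage e S → e x ∈ S
  ∈-preimage⁻ x∈ = lookup⇒[]= (e x) S (∈-tabulate⁻ x∈)

module _ (G : Graph) {A : Subset (n G)} {v : Fin (n G)} where
  open Equivalence

  ∈N⁺ : ∀ {u} → u ∈ A → adj G u v ≡ true → v ∈ N G A
  ∈N⁺ {u} u∈A uv = ∈-tabulate⁺ (to T-≡ (any⁺ _ (lose (∈-allFin u) (from T-∧ (u∈A′ , from T-≡ uv)))))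
    where u∈A′ = from T-≡ ([]=⇒lookup u∈A)

  ∈N⁻ : v ∈ N G A → ∃[ u ] u ∈ A × adj G u v ≡ true
  ∈N⁻ v∈ with satisfied (any⁻ _ (allFin (n G)) (from T-≡ (∈-tabulate⁻ v∈)))
  ... | u , Tu∧uv with to T-∧ Tu∧uv
  ...   | Tu , Tuv = u , lookup⇒[]= u A (to T-≡ Tu) , to T-≡ Tuv

module _ {G : Graph} (W : Strategy G) where

  ∈territory-suc⁺ : ∀ {t u v} → u ∈ territory G W t → adj G u v ≡ true → v ∉ W (suc t) →
                    v ∈ territory G W (suc t)
  ∈territory-suc⁺ u∈R uv v∉W = x∈p∧x∉q⇒x∈p─q (∈N⁺ G u∈R uv) v∉W

  ∈territory-suc⁻ : ∀ {t v} → v ∈ territory G W (suc t) →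
                    (∃[ u ] u ∈ territory G W t × adj G u v ≡ true) × v ∉ W (suc t)
  ∈territory-suc⁻ v∈R = ∈N⁻ G (p─q⊆p _ _ v∈R) , x∈p─q⇒x∉q v∈R

  Nonempty-territory-pred : ∀ {t} → Nonempty (territory G W (suc t)) → Nonempty (territory G W t)
  Nonempty-territory-pred (_ , v∈R) with proj₁ (∈territory-suc⁻ v∈R)
  ... | u , u∈R , _ = u , u∈R

territory-cong : ∀ {G : Graph} {V W : Strategy G} t → (∀ s → s ≤ t → V s ≡ W s) →
                 territory G V t ≡ territory G W t
territory-cong zero V≡W = cong ∁ (V≡W 0 z≤n)
territory-cong {G} (suc t) V≡W =
  cong₂ (λ A B → N G A ─ B) (territory-cong t (λ s s≤t → V≡W s (m≤n⇒m≤1+n s≤t))) (V≡W (suc t) ≤-refl)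

prefix-winning : ∀ {G : Graph} {W : Strategy G} {k} T → territory G W T ≡ ⊥ →
                 (∀ s → s ≤ T → ∣ W s ∣ ≤ k) → Wins G k
prefix-winning {G} {W} {k} T R≡⊥ bounded = V , (T , trans (territory-cong T V≡W) R≡⊥) , V-bounded
  where
    V : Strategy G
    V s with s ≤? T
    ... | yes _ = W s
    ... | no _  = ⊥

    V≡W : ∀ s → s ≤ T → V s ≡ W s
    V≡W s s≤T with s ≤? T
    ... | yes _   = refl
    ... | no s≰T = contradiction s≤T s≰T

    V-bounded : ∀ s → ∣ V s ∣ ≤ k
    V-bounded s with s ≤? T
    ... | yes s≤T = bounded s s≤T
    ... | no _    = subst (_≤ k) (sym (∣⊥∣≡0 (n G))) z≤n

prefix-below-hunting-number : ∀ {G : Graph} {W : Strategy G} {h} T → IsHuntingNumber G h →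
                              territory G W T ≡ ⊥ → ¬ (∀ s → s ≤ T → ∣ W s ∣ < h)
prefix-below-hunting-number {h = zero}  T _              _   below = n≮0 (below 0 z≤n)
prefix-below-hunting-number {h = suc h} T (_ , minimal) R≡⊥ below =
  1+n≰n (minimal h (prefix-winning T R≡⊥ (λ s s≤T → ≤-pred (below s s≤T))))

Wins-everywhere : (G : Graph) → Wins G (n G)
Wins-everywhere G =
  prefix-winning {W = λ _ → ⊤} 0 (Empty-unique everyone-shot) (λ _ _ → ≤-reflexive (∣⊤∣≡n (n G)))
  where
    everyone-shot : Empty (∁ ⊤)
    everyone-shot (_ , v∈∁⊤) = x∈∁p⇒x∉p v∈∁⊤ ∈⊤

module Restriction {J : Graph} (W : Strategy J) where

  Full : (Fin m → Fin (n J)) → ℕ → Set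
  Full e u = ∀ x → e x ∉ W u → e x ∈ territory J W u

  Full-zero : (e : Fin m → Fin (n J)) → Full e 0
  Full-zero _ _ = x∉p⇒x∈∁p

  Full∧Empty⇒covered : ∀ {e : Fin m → Fin (n J)} {u} → Full e u → Empty (preimage e (territory J W u)) →
                       ∀ x → e x ∈ W u
  Full∧Empty⇒covered {e = e} {u} full empty x with e x ∈? W u
  ... | yes ex∈W = ex∈W
  ... | no ex∉W  = ⊥-elim (empty (x , ∈-preimage⁺ (full x ex∉W)))

  preimageFrom : (Fin m → Fin (n J)) → ℕ → ℕ → Subset m
  preimageFrom e u s = preimage e (W (s + u))

  territory-preimageFrom : ∀ {X : Graph} {e : Fin (n X) → Fin (n J)} →
                           (∀ x x' → adj X x x' ≡ true → adj J (e x) (e x') ≡ true) → ∀ {u} → Full e u →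
                           ∀ i → territory X (preimageFrom e u) i ⊆ preimage e (territory J W (i + u))
  territory-preimageFrom e-adj full zero x∈R = ∈-preimage⁺ (full _ (x∈∁p⇒x∉p x∈R ∘ ∈-preimage⁺))
  territory-preimageFrom {X} {e} e-adj {u} full (suc i) x∈R
    with ∈territory-suc⁻ {X} (preimageFrom e u) {t = i} x∈R
  ... | (x' , x'∈R , x'x) , x∉V =
    ∈-preimage⁺ (∈territory-suc⁺ W {t = i + u} (∈-preimage⁻ (territory-preimageFrom e-adj full i x'∈R))
                                  (e-adj _ _ x'x) (x∉V ∘ ∈-preimage⁺))

-- J is presented as X ∇ Y through a bijection of vertex sets, so that every argument about the
-- left factor also applies to the right one (isJoin-sym).
record IsJoin (X Y J : Graph) : Set where
  field
    vertices : Fin (n J) ↔ (Fin (n X) ⊎ Fin (n Y))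

  open Inverse vertices using (to; from; strictlyInverseˡ; strictlyInverseʳ)

  inl : Fin (n X) → Fin (n J)
  inl x = from (inj₁ x)

  inr : Fin (n Y) → Fin (n J)
  inr y = from (inj₂ y)

  field
    adj-inl     : ∀ x x' → adj J (inl x) (inl x') ≡ adj X x x'
    adj-inr     : ∀ y y' → adj J (inr y) (inr y') ≡ adj Y y y'
    adj-inl-inr : ∀ x y → adj J (inl x) (inr y) ≡ true
    ∣∣-split    : ∀ S → ∣ S ∣ ≡ ∣ preimage inl S ∣ + ∣ preimage inr S ∣

  adj-inr-inl : ∀ y x → adj J (inr y) (inl x) ≡ true
  adj-inr-inl y x = trans (Graph.sym J (inr y) (inl x)) (adj-inl-inr x y)

  inl-or-inr : ∀ v → (∃[ x ] inl x ≡ v) ⊎ (∃[ y ] inr y ≡ v)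
  inl-or-inr v with to v | strictlyInverseʳ v
  ... | inj₁ x | inl[x]≡v = inj₁ (x , inl[x]≡v)
  ... | inj₂ y | inr[y]≡v = inj₂ (y , inr[y]≡v)

  Nonempty-split : ∀ {S} → Nonempty S → Nonempty (preimage inl S) ⊎ Nonempty (preimage inr S)
  Nonempty-split (v , v∈S) with inl-or-inr v
  ... | inj₁ (x , refl) = inj₁ (x , ∈-preimage⁺ v∈S)
  ... | inj₂ (y , refl) = inj₂ (y , ∈-preimage⁺ v∈S)

  glue : Subset (n X) → Subset (n Y) → Subset (n J)
  glue A B = tabulate (λ v → [ lookup A , lookup B ]′ (to v))

  lookup-glue : ∀ A B v → lookup (glue A B) v ≡ [ lookup A , lookup B ]′ (to v)
  lookup-glue A B = lookup∘tabulate _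

  preimage-inl-glue : ∀ A B → preimage inl (glue A B) ≡ A
  preimage-inl-glue A B = trans (tabulate-cong λ x → trans (lookup-glue A B (inl x))
                                                          (cong [ lookup A , lookup B ]′ (strictlyInverseˡ _)))
                                (tabulate∘lookup A)

  preimage-inr-glue : ∀ A B → preimage inr (glue A B) ≡ B
  preimage-inr-glue A B = trans (tabulate-cong λ y → trans (lookup-glue A B (inr y))
                                                          (cong [ lookup A , lookup B ]′ (strictlyInverseˡ _)))
                                (tabulate∘lookup B)

isJoin-sym : ∀ {X Y J} → IsJoin X Y J → IsJoin Y X J
isJoin-sym S = record
  { vertices    = swap-↔ ↔-∘ vertices
  ; adj-inl     = adj-inr
  ; adj-inr     = adj-inl
  ; adj-inl-inr = adj-inr-inl
  ; ∣∣-split    = λ P → trans (∣∣-split P) (+-comm ∣ preimage inl P ∣ ∣ preimage inr P ∣)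
  }
  where open IsJoin S

∣∣-split-↑ : ∀ m k (S : Subset (m + k)) → ∣ S ∣ ≡ ∣ preimage (_↑ˡ k) S ∣ + ∣ preimage (m ↑ʳ_) S ∣
∣∣-split-↑ zero    k S              = cong ∣_∣ (sym (tabulate∘lookup S))
∣∣-split-↑ (suc m) k (inside  ∷ S) = cong suc (∣∣-split-↑ m k S)
∣∣-split-↑ (suc m) k (outside ∷ S) = ∣∣-split-↑ m k S

∇-isJoin : (G H : Graph) → IsJoin G H (G ∇ H)
∇-isJoin G H = record
  { vertices    = +↔⊎
  ; adj-inl     = adj-↑ˡ
  ; adj-inr     = adj-↑ʳ
  ; adj-inl-inr = adj-↑ˡ-↑ʳ
  ; ∣∣-split    = ∣∣-split-↑ (n G) (n H)
  }
  where
    adj-↑ˡ : ∀ x x' → adj (G ∇ H) (x ↑ˡ n H) (x' ↑ˡ n H) ≡ adj G x x'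
    adj-↑ˡ x x' rewrite splitAt-↑ˡ (n G) x (n H) | splitAt-↑ˡ (n G) x' (n H) = refl

    adj-↑ʳ : ∀ y y' → adj (G ∇ H) (n G ↑ʳ y) (n G ↑ʳ y') ≡ adj H y y'
    adj-↑ʳ y y' rewrite splitAt-↑ʳ (n G) (n H) y | splitAt-↑ʳ (n G) (n H) y' = refl

    adj-↑ˡ-↑ʳ : ∀ x y → adj (G ∇ H) (x ↑ˡ n H) (n G ↑ʳ y) ≡ true
    adj-↑ˡ-↑ʳ x y rewrite splitAt-↑ˡ (n G) x (n H) | splitAt-↑ʳ (n G) (n H) y = refl

module _ {X Y J : Graph} (S : IsJoin X Y J) where
  open IsJoin S

  Wins-join : ∀ {c} → Wins X c → Wins J (c + n Y)
  Wins-join {c} (V , (T , R≡⊥) , bounded) = W , (T , Empty-unique R-empty) , W-bounded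
    where
      W : Strategy J
      W t = glue (V t) ⊤

      inl∈W : ∀ {t x} → x ∈ V t → inl x ∈ W t
      inl∈W {t} x∈V = ∈-preimage⁻ (subst (_ ∈_) (sym (preimage-inl-glue (V t) ⊤)) x∈V)

      inr∈W : ∀ {t} y → inr y ∈ W t
      inr∈W {t} y = ∈-preimage⁻ (subst (_ ∈_) (sym (preimage-inr-glue (V t) ⊤)) ∈⊤)

      territory-inl : ∀ t {v} → v ∈ territory J W t → ∃[ x ] inl x ≡ v × x ∈ territory X V t
      territory-inl zero {v} v∈R with inl-or-inr v
      ... | inj₁ (x , refl) = x , refl , x∉p⇒x∈∁p (x∈∁p⇒x∉p v∈R ∘ inl∈W)
      ... | inj₂ (y , refl) = contradiction (inr∈W y) (x∈∁p⇒x∉p v∈R)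
      territory-inl (suc t) {v} v∈R with ∈territory-suc⁻ W {t = t} v∈R | inl-or-inr v
      ... | _ , v∉W | inj₂ (y , refl) = contradiction (inr∈W y) v∉W
      ... | (u , u∈R , uv) , v∉W | inj₁ (x , refl) with territory-inl t u∈R
      ...   | x' , refl , x'∈R =
        x , refl , ∈territory-suc⁺ V {t = t} x'∈R (trans (sym (adj-inl x' x)) uv) (v∉W ∘ inl∈W)

      R-empty : Empty (territory J W T)
      R-empty (_ , v∈R) with territory-inl T v∈R
      ... | _ , _ , x∈R = ∉⊥ (subst (_ ∈_) R≡⊥ x∈R)

      W-bounded : ∀ t → ∣ W t ∣ ≤ c + n Y
      W-bounded t = begin
        ∣ W t ∣                                        ≡⟨ ∣∣-split (W t) ⟩
        ∣ preimage inl (W t) ∣ + ∣ preimage inr (W t) ∣ ≡⟨ cong₂ (λ A B → ∣ A ∣ + ∣ B ∣) (preimage-inl-glue (V t) ⊤)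
                                                                                       (preimage-inr-glue (V t) ⊤) ⟩
        ∣ V t ∣ + ∣ ⊤ {n Y} ∣                           ≤⟨ +-mono-≤ (bounded t) (≤-reflexive (∣⊤∣≡n _)) ⟩
        c + n Y                                        ∎
        where open ≤-Reasoning

module LowerBound {J : Graph} (W : Strategy J) {k : ℕ} (bounded : ∀ t → ∣ W t ∣ ≤ k) where
  open Restriction {J} W

  private
    R : ℕ → Subset (n J)
    R = territory J W

  Sparse : (Fin m → Fin (n J)) → ℕ → ℕ → Set
  Sparse e a s = ∣ preimage e (W s) ∣ < a

  data Hideout (e : Fin m → Fin (n J)) (a : ℕ) : ℕ → Set where
    hideout : ∀ u j → Full e u → (∀ s → s ≤ j → Sparse e a (s + u)) → Hideout e a (j + u)

  module _ {e : Fin m → Fin (n J)} {a : ℕ} where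

    hideout-start : ∀ {u} → Full e u → Sparse e a u → Hideout e a u
    hideout-start {u} full sparse = hideout u 0 full λ { _ z≤n → sparse }

    hideout-snoc : ∀ {t} → Hideout e a t → Sparse e a (suc t) → Hideout e a (suc t)
    hideout-snoc (hideout u j full sparse) sparse′ = hideout u (suc j) full sparse″
      where
        sparse″ : ∀ s → s ≤ suc j → Sparse e a (s + u)
        sparse″ s s≤1+j with m≤n⇒m<n∨m≡n s≤1+j
        ... | inj₁ s<1+j = sparse s (≤-pred s<1+j)
        ... | inj₂ refl  = sparse′

  Ongoing : ℕ → Set
  Ongoing zero    = Unit
  Ongoing (suc t) = Nonempty (R t)

  Ongoing-pred : ∀ t → Ongoing (suc t) → Ongoing t
  Ongoing-pred zero    _        = tt
  Ongoing-pred (suc t) nonempty = Nonempty-territory-pred {J} W nonempty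

  module _ {X Y : Graph} (S : IsJoin X Y J) where
    open IsJoin S

    hideout-escapes : ∀ {a t} → IsHuntingNumber X a → Hideout inl a t → ¬ Empty (preimage inl (R t))
    hideout-escapes hX (hideout u j full sparse) empty = prefix-below-hunting-number j hX R′≡⊥ sparse
      where
        inl-adj : ∀ x x' → adj X x x' ≡ true → adj J (inl x) (inl x') ≡ true
        inl-adj x x' xx' = trans (adj-inl x x') xx'

        R′≡⊥ : territory X (preimageFrom inl u) j ≡ ⊥
        R′≡⊥ = Empty-unique λ (x , x∈R′) → empty (x , territory-preimageFrom inl-adj full j x∈R′)

    Full-inl-after : ∀ {t} → Nonempty (preimage inr (R t)) → Full inl (suc t)
    Full-inl-after (y , y∈R) x = ∈territory-suc⁺ {J} W (∈-preimage⁻ y∈R) (adj-inr-inl y x)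

    Full-inr-after : ∀ {t} → Nonempty (preimage inl (R t)) → Full inr (suc t)
    Full-inr-after (x , x∈R) y = ∈territory-suc⁺ {J} W (∈-preimage⁻ x∈R) (adj-inl-inr x y)

    module _ {a b : ℕ} (k<a+b : k < a + b) where

      dense⇒sparse : ∀ {s} → b ≤ ∣ preimage inr (W s) ∣ → Sparse inl a s
      dense⇒sparse {s} b≤∣Wʸ∣ = +-cancelʳ-< b _ a (begin-strict
        ∣ preimage inl (W s) ∣ + b                      ≤⟨ +-monoʳ-≤ _ b≤∣Wʸ∣ ⟩
        ∣ preimage inl (W s) ∣ + ∣ preimage inr (W s) ∣ ≡⟨ ∣∣-split (W s) ⟨
        ∣ W s ∣                                        ≤⟨ bounded s ⟩
        k                                              <⟨ k<a+b ⟩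
        a + b                                          ∎)
        where open ≤-Reasoning

      sparse-or-sparse : ∀ s → Sparse inl a s ⊎ Sparse inr b s
      sparse-or-sparse s with ∣ preimage inr (W s) ∣ <? b
      ... | yes sparseʸ = inj₂ sparseʸ
      ... | no ¬sparseʸ = inj₁ (dense⇒sparse (≮⇒≥ ¬sparseʸ))

      covered⇒sparse : IsHuntingNumber Y b → ∀ {s} → (∀ y → inr y ∈ W s) → Sparse inl a s
      covered⇒sparse (_ , minimal) {s} covered = dense⇒sparse (begin
        b                      ≤⟨ minimal (n Y) (Wins-everywhere Y) ⟩
        n Y                    ≡⟨ ∣⊤∣≡n (n Y) ⟨
        ∣ ⊤ {n Y} ∣            ≤⟨ p⊆q⇒∣p∣≤∣q∣ {p = ⊤} (λ {y} _ → ∈-preimage⁺ (covered y)) ⟩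
        ∣ preimage inr (W s) ∣ ∎)
        where open ≤-Reasoning

      sparse-after : IsHuntingNumber Y b → ∀ {t} → Nonempty (preimage inl (R t)) →
                     Empty (preimage inr (R (suc t))) → Sparse inl a (suc t)
      sparse-after hY nonemptyˣ emptyʸ =
        covered⇒sparse hY (Full∧Empty⇒covered (Full-inr-after nonemptyˣ) emptyʸ)

  hideout-exists : ∀ {X Y a b} (S : IsJoin X Y J) → IsHuntingNumber X a → IsHuntingNumber Y b →
                   k < a + b → ∀ t → Ongoing t → Empty (preimage (IsJoin.inr S) (R t)) →
                   Hideout (IsJoin.inl S) a t
  hideout-exists S hX hY k<a+b zero _ emptyʸ =
    hideout-start (Full-zero inl) (covered⇒sparse S k<a+b hY (Full∧Empty⇒covered (Full-zero inr) emptyʸ))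
    where open IsJoin S
  hideout-exists {a = a} {b} S hX hY k<a+b (suc t) ongoing emptyʸ
    with nonempty? (preimage (IsJoin.inl S) (R t)) | nonempty? (preimage (IsJoin.inr S) (R t))
  ... | yes nonemptyˣ | yes nonemptyʸ =
    hideout-start (Full-inl-after S nonemptyʸ) (sparse-after S k<a+b hY nonemptyˣ emptyʸ)
  ... | yes nonemptyˣ | no ¬nonemptyʸ =
    hideout-snoc (hideout-exists S hX hY k<a+b t (Ongoing-pred t ongoing) ¬nonemptyʸ)
                 (sparse-after S k<a+b hY nonemptyˣ emptyʸ)
  ... | no ¬nonemptyˣ | yes nonemptyʸ with sparse-or-sparse S k<a+b (suc t)
  ...   | inj₁ sparseˣ = hideout-start (Full-inl-after S nonemptyʸ) sparseˣ
  ...   | inj₂ sparseʸ = ⊥-elim (hideout-escapes S′ hY hideoutʸ emptyʸ)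
    where
      S′ = isJoin-sym S
      hideoutʸ = hideout-snoc (hideout-exists S′ hY hX (subst (k <_) (+-comm a b) k<a+b) t
                                              (Ongoing-pred t ongoing) ¬nonemptyˣ) sparseʸ
  hideout-exists S hX hY k<a+b (suc t) ongoing emptyʸ | no ¬nonemptyˣ | no ¬nonemptyʸ
    with IsJoin.Nonempty-split S ongoing
  ... | inj₁ nonemptyˣ = contradiction nonemptyˣ ¬nonemptyˣ
  ... | inj₂ nonemptyʸ = contradiction nonemptyʸ ¬nonemptyʸ

  module _ {X Y a b} (S : IsJoin X Y J) (hX : IsHuntingNumber X a) (hY : IsHuntingNumber Y b)
           (k<a+b : k < a + b) where
    open IsJoin S

    territory-ongoing : ∀ t → Ongoing t → R t ≢ ⊥
    territory-ongoing t ongoing R≡⊥ =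
      hideout-escapes S hX (hideout-exists S hX hY k<a+b t ongoing (Empty-preimage inr)) (Empty-preimage inl)
      where
        Empty-preimage : ∀ {m} (e : Fin m → Fin (n J)) → Empty (preimage e (R t))
        Empty-preimage e (x , x∈) = ∉⊥ (subst (_ ∈_) R≡⊥ (∈-preimage⁻ x∈))

    territory-never-⊥ : ∀ t → R t ≢ ⊥
    territory-never-⊥ zero = territory-ongoing zero tt
    territory-never-⊥ (suc t) with nonempty? (R t)
    ... | yes nonempty = territory-ongoing (suc t) nonempty
    ... | no ¬nonempty = λ _ → territory-never-⊥ t (Empty-unique ¬nonempty)

Wins-join⇒≤ : ∀ {X Y J a b k} → IsJoin X Y J → IsHuntingNumber X a → IsHuntingNumber Y b →
              Wins J k → a + b ≤ k
Wins-join⇒≤ {a = a} {b} {k} S hX hY (W , (T , R≡⊥) , bounded) with a + b ≤? k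
... | yes a+b≤k = a+b≤k
... | no a+b≰k  = contradiction R≡⊥ (LowerBound.territory-never-⊥ W bounded S hX hY (≰⇒> a+b≰k) T)

lemma4 : (G H : Graph) (hG hH hGH : ℕ)
    → IsHuntingNumber G hG → IsHuntingNumber H hH → IsHuntingNumber (G ∇ H) hGH
    → (hG + hH ≤ hGH) × (hGH ≤ (hG + n H) ⊓ (hH + n G))
lemma4 G H hG hH hGH isG isH (winsGH , minimalGH) =
  Wins-join⇒≤ S isG isH winsGH ,
  ⊓-glb (minimalGH _ (Wins-join S (proj₁ isG))) (minimalGH _ (Wins-join (isJoin-sym S) (proj₁ isH)))
  where
    S = ∇-isJoin G H
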